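{- Let $\mathcal{M}$ be a simple oriented matroid on $E_m=\{1,\dots,m\}$ with covector set $\mathcal{L}$ and tope set $\mathcal{T}$. Let $\boldsymbol{R}=(T^0,T^1,\dots,T^{2m-1},T^0)$ be a symmetric cycle in the tope graph of $\mathcal{M}$ that does not contain the positive tope $(+\cdots+)$. Let $\boldsymbol{G}$ be the graph with vertex set $\{T^0,\dots,T^{2m-1}\}$ in which $T^k,T^l$ are adjacent iff $(T^k)^+\cup(T^l)^+=E_m$. Then $\mathrm{max}^+(\{T^0,\dots,T^{2m-1}\})$ is the vertex set of an odd cycle in $\boldsymbol{G}$.
   Context: Standing assumption: oriented matroids have rank at least $2$. An oriented matroid on $E$ is given by its covector set $\mathcal{L}\subseteq\{ -,0,+\}^E$; topes are covectors of inclusion-maximal support; $X^+:=\{e:X(e)=+\}$; $\mathbf{S}(X,Y):=\{e:X(e)=-Y(e)\ne0\}$. Simple: no loops, no parallel and no antiparallel elements ($e\neq f$ with $X(e)=-X(f)$ for all covectors $X$). The tope graph has the topes as vertices, two topes being adjacent iff they cover a common element of rank $r-1$ (a subtope) in the face lattice of covectors, where $r$ is the rank; for simple oriented matroids this means $|\mathbf{S}(T,T')|=1$. A cycle $(T^0,\dots,T^{2m-1},T^0)$ in the tope graph (with $m=|E|$) is symmetric if $T^{k+m}=-T^k$ for $0\le k\le m-1$. For a set $\mathcal{P}$ of sign vectors, $\mathrm{max}^+(\mathcal{P}):=\{P\in\mathcal{P}: P^+\text{ is inclusion-maximal in }\{R^+:R\in\mathcal{P}\}\}$. -}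

module Defs where

open import Data.Nat using (ℕ; zero; suc; _+_; _*_; _∸_; _<_; _≤_)
open import Data.Fin using (Fin)
open import Data.Product using (Σ; _×_; _,_; ∃)
open import Data.Sum using (_⊎_)
open import Relation.Nullary using (¬_)
open import Relation.Binary.PropositionalEquality using (_≡_; _≢_)

data Sign : Set where
  neg zer pos : Sign

-‿_ : Sign → Sign
-‿ neg = pos
-‿ zer = zer
-‿ pos = neg

SignVec : ℕ → Set
SignVec m = Fin m → Sign

module _ {m : ℕ} where

  _≈_ : SignVec m → SignVec m → Set
  X ≈ Y = ∀ e → X e ≡ Y e

  zeroV : SignVec m
  zeroV _ = zer

  posV : SignVec m
  posV _ = pos

  negV : SignVec m → SignVec m
  negV X e = -‿ (X e)

  compose : SignVec m → SignVec m → SignVec m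
  compose X Y e with X e
  ... | zer = Y e
  ... | s   = s

  Sep : SignVec m → SignVec m → Fin m → Set
  Sep X Y e = (X e ≡ -‿ (Y e)) × (X e ≢ zer)

  _≼_ : SignVec m → SignVec m → Set
  X ≼ Y = ∀ e → (X e ≡ zer) ⊎ (X e ≡ Y e)

  _≺_ : SignVec m → SignVec m → Set
  X ≺ Y = (X ≼ Y) × ¬ (X ≈ Y)

  _⊆supp_ : SignVec m → SignVec m → Set
  X ⊆supp Y = ∀ e → X e ≢ zer → Y e ≢ zer

  _⊆⁺_ : SignVec m → SignVec m → Set
  X ⊆⁺ Y = ∀ e → X e ≡ pos → Y e ≡ pos

record IsOrientedMatroid {m : ℕ} (L : SignVec m → Set) : Set where
  field
    L0 : L zeroV
    L1 : ∀ X → L X → L (negV X)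
    L2 : ∀ X Y → L X → L Y → L (compose X Y)
    L3 : ∀ X Y → L X → L Y → ∀ e → Sep X Y e →
         Σ (SignVec m) λ Z → L Z × (Z e ≡ zer) ×
           (∀ f → ¬ Sep X Y f → Z f ≡ compose X Y f)

module _ {m : ℕ} (L : SignVec m → Set) where

  RankAtLeast2 : Set
  RankAtLeast2 = Σ (SignVec m) λ X → Σ (SignVec m) λ Y →
    L X × L Y × (zeroV ≺ X) × (X ≺ Y)

  Simple : Set
  Simple =
    (∀ e → Σ (SignVec m) λ X → L X × (X e ≢ zer)) ×
    (∀ e f → e ≢ f → ¬ (∀ X → L X → X e ≡ X f)) ×
    (∀ e f → e ≢ f → ¬ (∀ X → L X → X e ≡ -‿ (X f)))

  IsTope : SignVec m → Set
  IsTope T = L T × (∀ Y → L Y → T ⊆supp Y → Y ⊆supp T)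

  Covers : SignVec m → SignVec m → Set
  Covers Y X = L X × L Y × (X ≺ Y) × (∀ Z → L Z → X ≺ Z → ¬ (Z ≺ Y))

  -- tope graph adjacency: distinct topes covering a common covector
  -- (which is then a subtope, i.e. of rank r-1)
  TopeAdj : SignVec m → SignVec m → Set
  TopeAdj T T' = IsTope T × IsTope T' × ¬ (T ≈ T') ×
    Σ (SignVec m) λ X → Covers T X × Covers T' X

  SymmetricCycle : (ℕ → SignVec m) → Set
  SymmetricCycle T =
    (∀ k → suc k < 2 * m → TopeAdj (T k) (T (suc k))) ×
    TopeAdj (T (2 * m ∸ 1)) (T 0) ×
    (∀ k l → k < l → l < 2 * m → ¬ (T k ≈ T l)) ×
    (∀ k → k < m → T (k + m) ≈ negV (T k))

module _ {m : ℕ} (T : ℕ → SignVec m) where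

  GAdj : ℕ → ℕ → Set
  GAdj k l = ∀ e → (T k e ≡ pos) ⊎ (T l e ≡ pos)

  InMaxPlus : ℕ → Set
  InMaxPlus k = k < 2 * m × (∀ l → l < 2 * m → T k ⊆⁺ T l → T l ⊆⁺ T k)

  MaxPlusIsOddCycle : Set
  MaxPlusIsOddCycle =
    Σ ℕ λ n → Σ (ℕ → ℕ) λ c →
      (Σ ℕ λ j → n ≡ suc (2 * j)) × (3 ≤ n) ×
      (∀ i → i < n → c i < 2 * m) ×
      (∀ i i' → i < i' → i' < n → c i ≢ c i') ×
      (∀ i → suc i < n → GAdj (c i) (c (suc i))) ×
      GAdj (c (n ∸ 1)) (c 0) ×
      (∀ k → InMaxPlus k → Σ ℕ λ i → i < n × c i ≡ k) ×
      (∀ i → i < n → InMaxPlus (c i))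

-- Adjacent topes of a simple oriented matroid differ in exactly one element, because a subtope
-- has a single zero (two zeros would be parallel or antiparallel).  Extend the symmetric cycle
-- periodically: step k flips one element ε k, with ε (k + m) = ε k, and every window of m steps
-- flips every element exactly once.  Call a step rising if it makes its element positive.  A tope
-- entered by a rising step and left by a falling one (a peak) beats every other tope of the cycle
-- on the element just flipped in or the element flipped out next, so max⁺ consists exactly of
-- the peaks.  A peak at m + r is a valley at r, so the peaks correspond to the turns r < m of the
-- rising pattern; there is an odd number of them because the pattern is reversed after m steps.
-- Between consecutive turns all steps go the same way, so the antipode of one peak lies below the
-- other in ⊆⁺, i.e. their positive parts cover E.  A single peak would cover itself and thus be
-- the positive tope, hence there are at least three.
module Submission where

open import Defs
open import Data.Bool using (Bool; true; false; not; if_then_else_; _xor_; T)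
open import Data.Bool.Properties using (not-involutive; xor-same; not-distribˡ-xor; not-distribʳ-xor)
open import Data.Empty using (⊥-elim)
open import Data.Fin using (Fin; toℕ; fromℕ<; punchOut)
open import Data.Fin.Properties using (any?; ¬∀⟶∃¬; toℕ-fromℕ<; punchOut-injective; injective⇒≤)
  renaming (_≟_ to _≟ᶠ_)
open import Data.Fin.Subset using (Subset; _∈_; _⊂_)
open import Data.Fin.Subset.Induction using (⊂-wellFounded; Acc; acc)
open import Data.Nat using (ℕ; zero; suc; _+_; _*_; _∸_; _<_; _≤_; _<ᵇ_; z≤n; s≤s)
open import Data.Nat.DivMod
  using (_%_; _/_; m%n<n; m≡m%n+[m/n]*n; m%n%n≡m%n; %-distribˡ-+; m<n⇒m%n≡m; n%n≡0; [m+n]%n≡m%n)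
open import Data.Nat.Properties
  using (_≤?_; _<?_; +-assoc; +-comm; +-suc; +-identityʳ; +-cancelʳ-<; +-cancelˡ-<; +-cancelˡ-≡; +-monoʳ-<;
         <-irrefl; <-trans; <-≤-trans; ≤-<-trans; ≤-trans; ≤-refl; ≤-reflexive; ≤-antisym; ≤-pred; <⇒≤;
         ≤⇒≯; ≮⇒≥; ≰⇒>; n<1+n; n≤1+n; m<n⇒m<1+n; m≤m+n; m≤n+m; m≤n⇒m<n∨m≡n; m≤n⇒∃[o]m+o≡n; <ᵇ⇒<; <⇒<ᵇ)
open import Data.Product using (Σ; _×_; _,_; proj₁; proj₂)
open import Data.Sum using (_⊎_; inj₁; inj₂; swap; map; map₂; [_,_]′)
open import Data.Vec using (tabulate)
open import Data.Vec.Properties using (lookup∘tabulate; lookup⇒[]=; []=⇒lookup)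
open import Function using (_∘_; id)
open import Relation.Nullary using (¬_; Dec; yes; no; does; contradiction)
open import Relation.Nullary.Decidable using (_×-dec_; ¬?; dec-true; decidable-stable)
open import Relation.Binary.PropositionalEquality
  using (_≡_; _≢_; refl; sym; trans; cong; cong₂; subst; subst₂; module ≡-Reasoning)

infix 4 _≟ˢ_
_≟ˢ_ : (a b : Sign) → Dec (a ≡ b)
neg ≟ˢ neg = yes refl
neg ≟ˢ zer = no λ ()
neg ≟ˢ pos = no λ ()
zer ≟ˢ neg = no λ ()
zer ≟ˢ zer = yes refl
zer ≟ˢ pos = no λ ()
pos ≟ˢ neg = no λ ()
pos ≟ˢ zer = no λ ()
pos ≟ˢ pos = yes refl

-‿-involutive : ∀ a → -‿ (-‿ a) ≡ a
-‿-involutive neg = refl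
-‿-involutive zer = refl
-‿-involutive pos = refl

-‿-nonzero : ∀ {a} → a ≢ zer → -‿ a ≢ zer
-‿-nonzero {neg} _ ()
-‿-nonzero {zer} a≢0 _ = a≢0 refl
-‿-nonzero {pos} _ ()

-‿-≢ : ∀ {a} → a ≢ zer → -‿ a ≢ a
-‿-≢ {neg} _ ()
-‿-≢ {zer} a≢0 _ = a≢0 refl
-‿-≢ {pos} _ ()

-‿-injective : ∀ {a b} → -‿ a ≡ -‿ b → a ≡ b
-‿-injective {a} {b} eq = trans (sym (-‿-involutive a)) (trans (cong -‿_ eq) (-‿-involutive b))

nonzero-≢⇒opposite : ∀ {a b} → a ≢ zer → b ≢ zer → a ≢ b → a ≡ -‿ b
nonzero-≢⇒opposite {neg} {neg} _ _ a≢b = contradiction refl a≢b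
nonzero-≢⇒opposite {neg} {pos} _ _ _ = refl
nonzero-≢⇒opposite {pos} {neg} _ _ _ = refl
nonzero-≢⇒opposite {pos} {pos} _ _ a≢b = contradiction refl a≢b
nonzero-≢⇒opposite {zer} a≢0 _ _ = contradiction refl a≢0
nonzero-≢⇒opposite {_} {zer} _ b≢0 _ = contradiction refl b≢0

nonzero-≢-opposite⇒≡ : ∀ {a b} → a ≢ zer → b ≢ zer → a ≢ -‿ b → a ≡ b
nonzero-≢-opposite⇒≡ {a} {b} a≢0 b≢0 a≢-b with a ≟ˢ b
... | yes a≡b = a≡b
... | no a≢b = contradiction (nonzero-≢⇒opposite a≢0 b≢0 a≢b) a≢-b

isPos : Sign → Bool
isPos pos = true
isPos _ = false

isPos-opposite : ∀ {a} → a ≢ zer → isPos (-‿ a) ≡ not (isPos a)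
isPos-opposite {neg} _ = refl
isPos-opposite {zer} a≢0 = contradiction refl a≢0
isPos-opposite {pos} _ = refl

module _ {m : ℕ} where

  compose-zeroˡ : ∀ (X Y : SignVec m) {e} → X e ≡ zer → compose X Y e ≡ Y e
  compose-zeroˡ X Y {e} Xe≡0 rewrite Xe≡0 = refl

  compose-nonzeroˡ : ∀ (X Y : SignVec m) {e} → X e ≢ zer → compose X Y e ≡ X e
  compose-nonzeroˡ X Y {e} Xe≢0 with X e
  ... | neg = refl
  ... | zer = contradiction refl Xe≢0
  ... | pos = refl

  compose-nonzeroʳ : ∀ (X Y : SignVec m) {e} → Y e ≢ zer → compose X Y e ≢ zer
  compose-nonzeroʳ X Y {e} Ye≢0 with X e
  ... | neg = λ ()
  ... | zer = Ye≢0
  ... | pos = λ ()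

  Sep? : ∀ X Y e → Dec (Sep {m} X Y e)
  Sep? X Y e = (X e ≟ˢ -‿ Y e) ×-dec ¬? (X e ≟ˢ zer)

  FlipAt : SignVec m → SignVec m → Fin m → Set
  FlipAt X Y e = (Y e ≡ -‿ X e) × (∀ f → f ≢ e → Y f ≡ X f)

  ≼-nonzero : ∀ {X Y : SignVec m} {e} → X ≼ Y → X e ≢ zer → Y e ≡ X e
  ≼-nonzero X≼Y Xe≢0 with X≼Y _
  ... | inj₁ Xe≡0 = contradiction Xe≡0 Xe≢0
  ... | inj₂ Xe≡Ye = sym Xe≡Ye

module _ {m : ℕ} {L : SignVec m → Set} (om : IsOrientedMatroid L) where
  open IsOrientedMatroid om

  tope-fullSupport : (∀ e → Σ (SignVec m) λ X → L X × (X e ≢ zer)) →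
                     ∀ {T} → IsTope L T → ∀ e → T e ≢ zer
  tope-fullSupport loopless {T} (LT , maximal) e Te≡0 =
    maximal (compose T X) (L2 T X LT LX) T⊆T∘X e (compose-nonzeroʳ T X Xe≢0) Te≡0
    where
      X = proj₁ (loopless e)
      LX = proj₁ (proj₂ (loopless e))
      Xe≢0 = proj₂ (proj₂ (loopless e))
      T⊆T∘X : T ⊆supp compose T X
      T⊆T∘X f Tf≢0 rewrite compose-nonzeroˡ T X Tf≢0 = Tf≢0

  module Subtope {T X : SignVec m} (LT : L T) (LX : L X) (T-full : ∀ e → T e ≢ zer) (X≼T : X ≼ T)
                 (covered : ∀ Z → L Z → X ≺ Z → ¬ (Z ≺ T)) where

    AgreeOnZeros : SignVec m → SignVec m → Set
    AgreeOnZeros W V = ∀ e → X e ≡ zer → W e ≡ V e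

    ZeroOr±T : SignVec m → Set
    ZeroOr±T W = AgreeOnZeros W zeroV ⊎ AgreeOnZeros W T ⊎ AgreeOnZeros W (negV T)

    separators : SignVec m → Subset m
    separators W = tabulate λ e → does (Sep? W T e)

    separator⁺ : ∀ W {e} → Sep W T e → e ∈ separators W
    separator⁺ W {e} s = lookup⇒[]= e _ (trans (lookup∘tabulate _ e) (dec-true (Sep? W T e) s))

    separator⁻ : ∀ W {e} → e ∈ separators W → Sep W T e
    separator⁻ W {e} e∈ = witness (Sep? W T e) (trans (sym (lookup∘tabulate _ e)) ([]=⇒lookup e∈))
      where
        witness : ∀ {A : Set} (a? : Dec A) → does a? ≡ true → A
        witness (yes a) _ = a

    unseparated-above : ∀ {W} → L W → X ≼ W → (∀ e → X e ≡ zer → W e ≢ -‿ T e) →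
                        AgreeOnZeros W zeroV ⊎ AgreeOnZeros W T
    unseparated-above {W} LW X≼W unseparated with any? (λ h → (X h ≟ˢ zer) ×-dec ¬? (W h ≟ˢ zer))
    ... | no noSupport = inj₁ λ e Xe≡0 → decidable-stable (W e ≟ˢ zer) λ We≢0 → noSupport (e , Xe≡0 , We≢0)
    ... | yes (h , Xh≡0 , Wh≢0) = inj₂ λ e _ → decidable-stable (W e ≟ˢ T e) λ We≢Te →
          covered W LW (X≼W , λ X≈W → Wh≢0 (trans (sym (X≈W h)) Xh≡0)) (W≼T , λ W≈T → We≢Te (W≈T e))
      where
        W≼T : W ≼ T
        W≼T e with X e ≟ˢ zer | W e ≟ˢ zer
        ... | no Xe≢0 | _ = inj₂ (trans (≼-nonzero X≼W Xe≢0) (sym (≼-nonzero X≼T Xe≢0)))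
        ... | yes _ | yes We≡0 = inj₁ We≡0
        ... | yes Xe≡0 | no We≢0 = inj₂ (nonzero-≢-opposite⇒≡ We≢0 (T-full e) (unseparated e Xe≡0))

    eliminate-separator : ∀ {W g h} → L W → X ≼ W → W g ≡ -‿ T g → W h ≢ -‿ T h →
                          Σ (SignVec m) λ Z → L Z × X ≼ Z × separators Z ⊂ separators W ×
                                              Z g ≡ zer × Z h ≢ zer × Z h ≢ -‿ T h
    eliminate-separator {W} {g} {h} LW X≼W Wg≡-Tg Wh≢-Th with L3 W T LW LT g (Wg≡-Tg , Wg≢0)
      where Wg≢0 = λ Wg≡0 → -‿-nonzero (T-full g) (trans (sym Wg≡-Tg) Wg≡0)
    ... | Z , LZ , Zg≡0 , Z≡W∘T = Z , LZ , X≼Z , Z⊂W , Zg≡0 , Zh≢0 , Zh≢-Th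
      where
        Z≡W∘T-off : ∀ {e} → ¬ Sep W T e → Z e ≡ compose W T e
        Z≡W∘T-off = Z≡W∘T _

        W∘T-unseparated : ∀ {e} → ¬ Sep W T e → ¬ Sep (compose W T) T e
        W∘T-unseparated {e} noSep (s , _) with W e ≟ˢ zer
        ... | yes We≡0 = -‿-≢ (T-full e) (sym (trans (sym (compose-zeroˡ W T We≡0)) s))
        ... | no We≢0 = noSep (trans (sym (compose-nonzeroˡ W T We≢0)) s , We≢0)

        X≼Z : X ≼ Z
        X≼Z e with X e ≟ˢ zer
        ... | yes Xe≡0 = inj₁ Xe≡0
        ... | no Xe≢0 = inj₂ (sym (trans (Z≡W∘T-off noSep) (trans (compose-nonzeroˡ W T We≢0) We≡Xe)))
          where
            We≡Xe = ≼-nonzero X≼W Xe≢0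
            We≢0 = λ We≡0 → Xe≢0 (trans (sym We≡Xe) We≡0)
            noSep : ¬ Sep W T e
            noSep (We≡-Te , _) = -‿-≢ Xe≢0 (sym (trans (sym We≡Xe) (trans We≡-Te (cong -‿_ (≼-nonzero X≼T Xe≢0)))))

        Z⊂W : separators Z ⊂ separators W
        Z⊂W = Z⊆W , g , separator⁺ W (Wg≡-Tg , Wg≢0) , λ g∈ → proj₂ (separator⁻ Z g∈) Zg≡0
          where
            Wg≢0 = λ Wg≡0 → -‿-nonzero (T-full g) (trans (sym Wg≡-Tg) Wg≡0)
            Z⊆W : ∀ {e} → e ∈ separators Z → e ∈ separators W
            Z⊆W {e} e∈Z with Sep? W T e | separator⁻ Z e∈Z
            ... | yes s | _ = separator⁺ W s
            ... | no noSep | (Ze≡-Te , Ze≢0) = ⊥-elim (W∘T-unseparated noSep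
                  (trans (sym (Z≡W∘T-off noSep)) Ze≡-Te , Ze≢0 ∘ trans (Z≡W∘T-off noSep)))

        h-unseparated : ¬ Sep W T h
        h-unseparated = Wh≢-Th ∘ proj₁

        Zh≢0 : Z h ≢ zer
        Zh≢0 = compose-nonzeroʳ W T (T-full h) ∘ trans (sym (Z≡W∘T-off h-unseparated))

        Zh≢-Th : Z h ≢ -‿ T h
        Zh≢-Th Zh≡-Th = W∘T-unseparated h-unseparated
          (trans (sym (Z≡W∘T-off h-unseparated)) Zh≡-Th , compose-nonzeroʳ W T (T-full h))

    -- Well-founded induction on the separators of W and T: eliminating W and T at a separator
    -- keeps the covector above X and removes that separator.
    above-subtope : ∀ {W} → Acc _⊂_ (separators W) → L W → X ≼ W → ZeroOr±T W
    above-subtope {W} (acc rec) LW X≼W with any? (λ g → (X g ≟ˢ zer) ×-dec (W g ≟ˢ -‿ T g))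
    ... | no noSeparator = map₂ inj₁ (unseparated-above LW X≼W λ e Xe≡0 s → noSeparator (e , Xe≡0 , s))
    ... | yes (g , Xg≡0 , Wg≡-Tg) with any? (λ h → (X h ≟ˢ zer) ×-dec ¬? (W h ≟ˢ -‿ T h))
    ...   | no noOther = inj₂ (inj₂ λ e Xe≡0 →
            decidable-stable (W e ≟ˢ -‿ T e) λ We≢-Te → noOther (e , Xe≡0 , We≢-Te))
    ...   | yes (h , Xh≡0 , Wh≢-Th) with eliminate-separator LW X≼W Wg≡-Tg Wh≢-Th
    ...     | Z , LZ , X≼Z , Z⊂W , Zg≡0 , Zh≢0 , Zh≢-Th with above-subtope (rec Z⊂W) LZ X≼Z
    ...       | inj₁ Z≡0 = contradiction (Z≡0 h Xh≡0) Zh≢0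
    ...       | inj₂ (inj₁ Z≡T) = contradiction (trans (sym (Z≡T g Xg≡0)) Zg≡0) (T-full g)
    ...       | inj₂ (inj₂ Z≡-T) = contradiction (Z≡-T h Xh≡0) Zh≢-Th

    covector-on-zeros : ∀ {Y} → L Y → ZeroOr±T Y
    covector-on-zeros {Y} LY =
      map restrict (map restrict restrict) (above-subtope (⊂-wellFounded _) (L2 X Y LX LY) X≼X∘Y)
      where
        X≼X∘Y : X ≼ compose X Y
        X≼X∘Y e with X e ≟ˢ zer
        ... | yes Xe≡0 = inj₁ Xe≡0
        ... | no Xe≢0 = inj₂ (sym (compose-nonzeroˡ X Y Xe≢0))
        restrict : ∀ {V} → AgreeOnZeros (compose X Y) V → AgreeOnZeros Y V
        restrict X∘Y≡V e Xe≡0 = trans (sym (compose-zeroˡ X Y Xe≡0)) (X∘Y≡V e Xe≡0)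

    zero-unique : Simple L → ∀ {e f} → X e ≡ zer → X f ≡ zer → e ≡ f
    zero-unique (_ , no-parallel , no-antiparallel) {e} {f} Xe≡0 Xf≡0 with e ≟ᶠ f
    ... | yes e≡f = e≡f
    ... | no e≢f with T e ≟ˢ T f
    ...   | yes Te≡Tf = ⊥-elim (no-parallel e f e≢f parallel)
      where
        parallel : ∀ Y → L Y → Y e ≡ Y f
        parallel Y LY with covector-on-zeros LY
        ... | inj₁ Y≡0 = trans (Y≡0 e Xe≡0) (sym (Y≡0 f Xf≡0))
        ... | inj₂ (inj₁ Y≡T) = trans (Y≡T e Xe≡0) (trans Te≡Tf (sym (Y≡T f Xf≡0)))
        ... | inj₂ (inj₂ Y≡-T) = trans (Y≡-T e Xe≡0) (trans (cong -‿_ Te≡Tf) (sym (Y≡-T f Xf≡0)))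
    ...   | no Te≢Tf = ⊥-elim (no-antiparallel e f e≢f antiparallel)
      where
        Te≡-Tf = nonzero-≢⇒opposite (T-full e) (T-full f) Te≢Tf
        antiparallel : ∀ Y → L Y → Y e ≡ -‿ Y f
        antiparallel Y LY with covector-on-zeros LY
        ... | inj₁ Y≡0 = trans (Y≡0 e Xe≡0) (sym (cong -‿_ (Y≡0 f Xf≡0)))
        ... | inj₂ (inj₁ Y≡T) = trans (Y≡T e Xe≡0) (trans Te≡-Tf (cong -‿_ (sym (Y≡T f Xf≡0))))
        ... | inj₂ (inj₂ Y≡-T) = trans (Y≡-T e Xe≡0) (trans (cong -‿_ Te≡-Tf) (cong -‿_ (sym (Y≡-T f Xf≡0))))

  adjacent-topes-flip : Simple L → ∀ {T T'} → TopeAdj L T T' → Σ (Fin m) (FlipAt T T')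
  adjacent-topes-flip simple {T} {T'}
    (tope-T , tope-T' , T≉T' , X , (LX , LT , (X≼T , _) , covered) , (_ , _ , (X≼T' , _) , _)) =
    e , T'e≡-Te , T'≡T-off
    where
      T-full = tope-fullSupport (proj₁ simple) tope-T
      T'-full = tope-fullSupport (proj₁ simple) tope-T'
      open Subtope LT LX T-full X≼T covered using (zero-unique)
      difference = ¬∀⟶∃¬ m (λ e → T e ≡ T' e) (λ e → T e ≟ˢ T' e) T≉T'
      e = proj₁ difference
      T'e≡-Te = nonzero-≢⇒opposite (T'-full e) (T-full e) λ T'e≡Te → proj₂ difference (sym T'e≡Te)
      agree : ∀ {f} → X f ≢ zer → T' f ≡ T f
      agree Xf≢0 = trans (≼-nonzero X≼T' Xf≢0) (sym (≼-nonzero X≼T Xf≢0))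
      Xe≡0 : X e ≡ zer
      Xe≡0 = decidable-stable (X e ≟ˢ zer) (proj₂ difference ∘ sym ∘ agree)
      T'≡T-off : ∀ f → f ≢ e → T' f ≡ T f
      T'≡T-off f f≢e with X f ≟ˢ zer
      ... | yes Xf≡0 = ⊥-elim (f≢e (zero-unique simple Xf≡0 Xe≡0))
      ... | no Xf≢0 = agree Xf≢0

module Enumeration (P : ℕ → Bool) where

  count : ℕ → ℕ
  count zero = zero
  count (suc n) = if P n then suc (count n) else count n

  -- nth B i is the i-th place (from 0) below B where P holds, provided i < count B.
  nth : ℕ → ℕ → ℕ
  nth zero _ = zero
  nth (suc B) i = if i <ᵇ count B then nth B i else B

  count-suc-hit : ∀ {r} → P r ≡ true → count (suc r) ≡ suc (count r)
  count-suc-hit {r} Pr rewrite Pr = refl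

  count-≤-suc : ∀ n → count n ≤ count (suc n)
  count-≤-suc n with P n
  ... | true = n≤1+n _
  ... | false = ≤-refl

  count-mono : ∀ {a b} → a ≤ b → count a ≤ count b
  count-mono {b = zero} z≤n = ≤-refl
  count-mono {b = suc b} a≤1+b with m≤n⇒m<n∨m≡n a≤1+b
  ... | inj₁ (s≤s a≤b) = ≤-trans (count-mono a≤b) (count-≤-suc b)
  ... | inj₂ refl = ≤-refl

  hit-count< : ∀ {r b} → P r ≡ true → r < b → count r < count b
  hit-count< Pr r<b = subst (_≤ _) (count-suc-hit Pr) (count-mono r<b)

  nth-spec : ∀ B {i} → i < count B → nth B i < B × P (nth B i) ≡ true × count (nth B i) ≡ i
  nth-spec (suc B) {i} i<count with i <ᵇ count B in lt | P B in PB
  ... | true | _ = let (bound , hit , rank) = nth-spec B (<ᵇ⇒< i (count B) (subst T (sym lt) _))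
                   in ≤-trans bound (n≤1+n B) , hit , rank
  ... | false | true with m≤n⇒m<n∨m≡n i<count
  ...   | inj₁ (s≤s i<count') = contradiction (subst T lt (<⇒<ᵇ i<count')) λ ()
  ...   | inj₂ refl = ≤-refl , PB , refl
  nth-spec (suc B) {i} i<count | false | false = contradiction (subst T lt (<⇒<ᵇ i<count)) λ ()

  nth-count : ∀ B {r} → r < B → P r ≡ true → nth B (count r) ≡ r
  nth-count (suc B) {r} r<1+B Pr with count r <ᵇ count B in lt | m≤n⇒m<n∨m≡n r<1+B
  ... | true | inj₁ (s≤s r<B) = nth-count B r<B Pr
  ... | true | inj₂ refl = contradiction (<ᵇ⇒< (count r) (count r) (subst T (sym lt) _)) (<-irrefl refl)
  ... | false | inj₁ (s≤s r<B) = contradiction (subst T lt (<⇒<ᵇ (hit-count< Pr r<B))) λ ()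
  ... | false | inj₂ refl = refl

  module _ (B : ℕ) {i : ℕ} (i<count : i < count B) where

    nth-bound : nth B i < B
    nth-bound = proj₁ (nth-spec B i<count)

    nth-hit : P (nth B i) ≡ true
    nth-hit = proj₁ (proj₂ (nth-spec B i<count))

    count-nth : count (nth B i) ≡ i
    count-nth = proj₂ (proj₂ (nth-spec B i<count))

  no-hit-between : ∀ {a r b} → a < r → r < b → count b ≤ count (suc a) → P r ≡ false
  no-hit-between {r = r} a<r r<b count-b≤ with P r in Pr
  ... | false = refl
  ... | true = contradiction (≤-<-trans (≤-trans count-b≤ (count-mono a<r)) (hit-count< Pr r<b)) (<-irrefl refl)

  module _ (B : ℕ) where

    nth-injective : ∀ {i j} → i < count B → j < count B → nth B i ≡ nth B j → i ≡ j
    nth-injective i<count j<count nth-i≡nth-j =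
      trans (sym (count-nth B i<count)) (trans (cong count nth-i≡nth-j) (count-nth B j<count))

    nth-increasing : ∀ {i} → suc i < count B → nth B i < nth B (suc i)
    nth-increasing {i} 1+i<count = ≰⇒> λ nth-1+i≤nth-i → <-irrefl refl
      (subst₂ _≤_ (count-nth B 1+i<count) (count-nth B i<count) (count-mono nth-1+i≤nth-i))
      where i<count = ≤-<-trans (n≤1+n i) 1+i<count

    count-after : ∀ {i} → i < count B → count (suc (nth B i)) ≡ suc i
    count-after i<count = trans (count-suc-hit (nth-hit B i<count)) (cong suc (count-nth B i<count))

    no-hit-between-consecutive : ∀ {i r} → suc i < count B → nth B i < r → r < nth B (suc i) → P r ≡ false
    no-hit-between-consecutive {i} 1+i<count nth-i<r r<nth-1+i = no-hit-between nth-i<r r<nth-1+i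
      (≤-reflexive (trans (count-nth B 1+i<count) (sym (count-after (≤-<-trans (n≤1+n i) 1+i<count)))))

    no-hit-before-first : ∀ {r} → 0 < count B → r < nth B 0 → P r ≡ false
    no-hit-before-first {r} 0<count r<nth-0 with P r in Pr
    ... | false = refl
    ... | true = contradiction (subst (count r <_) (count-nth B 0<count) (hit-count< Pr r<nth-0)) λ ()

    no-hit-after-last : ∀ {i r} → count B ≡ suc i → nth B i < r → r < B → P r ≡ false
    no-hit-after-last {i} count≡1+i nth-i<r r<B = no-hit-between nth-i<r r<B
      (≤-reflexive (trans count≡1+i (sym (count-after (subst (i <_) (sym count≡1+i) ≤-refl)))))

odd : ℕ → Bool
odd zero = false
odd (suc n) = not (odd n)

odd⇒1+2* : ∀ n → odd n ≡ true → Σ ℕ λ j → n ≡ suc (2 * j)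
odd⇒1+2* zero ()
odd⇒1+2* (suc zero) _ = 0 , refl
odd⇒1+2* (suc (suc n)) odd-n with odd⇒1+2* n (trans (sym (not-involutive (odd n))) odd-n)
... | j , refl = suc j , cong suc (sym (+-suc (suc j) (j + 0)))

xor≡true⇒≡not : ∀ {b c} → b xor c ≡ true → c ≡ not b
xor≡true⇒≡not {true} {false} _ = refl
xor≡true⇒≡not {false} {true} _ = refl

xor≡false⇒≡ : ∀ {b c} → b xor c ≡ false → c ≡ b
xor≡false⇒≡ {true} {true} _ = refl
xor≡false⇒≡ {false} {false} _ = refl

2*n≡n+n : ∀ n → 2 * n ≡ n + n
2*n≡n+n n = cong (n +_) (+-identityʳ n)

module Changes (s : ℕ → Bool) where

  changes : ℕ → Bool
  changes r = s r xor s (suc r)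

  open Enumeration changes

  count-changes-odd : ∀ n → odd (count n) ≡ s 0 xor s n
  count-changes-odd zero = sym (xor-same (s 0))
  count-changes-odd (suc n) with changes n in change
  ... | true = trans (cong not (count-changes-odd n))
                     (trans (not-distribʳ-xor (s 0) (s n)) (cong (s 0 xor_) (sym (xor≡true⇒≡not change))))
  ... | false = trans (count-changes-odd n) (cong (s 0 xor_) (sym (xor≡false⇒≡ change)))

  no-changes⇒constant : ∀ x d → (∀ u → u < d → changes (x + u) ≡ false) → s (x + d) ≡ s x
  no-changes⇒constant x zero _ = cong s (+-identityʳ x)
  no-changes⇒constant x (suc d) unchanged = begin
    s (x + suc d)    ≡⟨ cong s (+-suc x d) ⟩
    s (suc (x + d))  ≡⟨ xor≡false⇒≡ (unchanged d ≤-refl) ⟩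
    s (x + d)        ≡⟨ no-changes⇒constant x d (λ u u<d → unchanged u (m<n⇒m<1+n u<d)) ⟩
    s x              ∎
    where open ≡-Reasoning

module FlipSequence (m₀ : ℕ) (U : ℕ → SignVec (suc m₀))
  (full : ∀ k e → U k e ≢ zer)
  (step : ∀ k → Σ (Fin (suc m₀)) (FlipAt (U k) (U (suc k))))
  (antipodal : ∀ k → U (k + suc m₀) ≈ negV (U k)) where

  m M : ℕ
  m = suc m₀
  M = 2 * m

  ε : ℕ → Fin m
  ε k = proj₁ (step k)

  ε-flips : ∀ k → U (suc k) (ε k) ≡ -‿ U k (ε k)
  ε-flips k = proj₁ (proj₂ (step k))

  others-kept : ∀ k {f} → f ≢ ε k → U (suc k) f ≡ U k f
  others-kept k = proj₂ (proj₂ (step k)) _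

  antipodal-≢ : ∀ k e → U (k + m) e ≢ U k e
  antipodal-≢ k e eq = -‿-≢ (full k e) (trans (sym (antipodal k e)) eq)

  U-period : ∀ k → U (k + M) ≈ U k
  U-period k e = begin
    U (k + M) e       ≡⟨ cong (λ i → U i e) (trans (cong (k +_) (2*n≡n+n m)) (sym (+-assoc k m m))) ⟩
    U (k + m + m) e   ≡⟨ antipodal (k + m) e ⟩
    -‿ U (k + m) e    ≡⟨ cong -‿_ (antipodal k e) ⟩
    -‿ (-‿ U k e)     ≡⟨ -‿-involutive (U k e) ⟩
    U k e             ∎
    where open ≡-Reasoning

  U-period-multiple : ∀ q k → U (k + q * M) ≈ U k
  U-period-multiple zero k e = cong (λ i → U i e) (+-identityʳ k)
  U-period-multiple (suc q) k e =
    trans (cong (λ i → U i e) (sym (+-assoc k M (q * M))))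
          (trans (U-period-multiple q (k + M) e) (U-period k e))

  U-mod : ∀ k → U k ≈ U (k % M)
  U-mod k e = trans (cong (λ i → U i e) (m≡m%n+[m/n]*n k M)) (U-period-multiple (k / M) (k % M) e)

  ε-antipodal : ∀ k → ε (k + m) ≡ ε k
  ε-antipodal k with ε (k + m) ≟ᶠ ε k
  ... | yes εk+m≡εk = εk+m≡εk
  ... | no εk+m≢εk = contradiction (trans (sym (ε-flips k)) kept) (-‿-≢ (full k (ε k)))
    where
      kept : U (suc k) (ε k) ≡ U k (ε k)
      kept = -‿-injective (trans (sym (antipodal (suc k) (ε k)))
               (trans (others-kept (k + m) (εk+m≢εk ∘ sym)) (antipodal k (ε k))))

  unflipped-constant : ∀ x e d → (∀ t → t < d → ε (x + t) ≢ e) → U (x + d) e ≡ U x e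
  unflipped-constant x e zero _ = cong (λ i → U i e) (+-identityʳ x)
  unflipped-constant x e (suc d) unflipped = begin
    U (x + suc d) e   ≡⟨ cong (λ i → U i e) (+-suc x d) ⟩
    U (suc (x + d)) e ≡⟨ others-kept (x + d) (unflipped d ≤-refl ∘ sym) ⟩
    U (x + d) e       ≡⟨ unflipped-constant x e d (λ t t<d → unflipped t (m<n⇒m<1+n t<d)) ⟩
    U x e             ∎
    where open ≡-Reasoning

  every-element-flips : ∀ i e → Σ (Fin m) λ r → ε (i + toℕ r) ≡ e
  every-element-flips i e with any? (λ r → ε (i + toℕ r) ≟ᶠ e)
  ... | yes found = found
  ... | no none = contradiction (unflipped-constant i e m unflipped) (antipodal-≢ i e)
    where
      unflipped : ∀ t → t < m → ε (i + t) ≢ e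
      unflipped t t<m εi+t≡e = none (fromℕ< t<m , trans (cong (λ t → ε (i + t)) (toℕ-fromℕ< t<m)) εi+t≡e)

  -- A window of m steps flips each of the m elements (every-element-flips); flipping one of them
  -- twice would inject the m elements into the m - 1 remaining positions.
  flip-unique : ∀ k {d} → 0 < d → d < m → ε (k + d) ≢ ε k
  flip-unique k {d} 0<d d<m εk+d≡εk = <-irrefl refl (injective⇒≤ punched-injective)
    where
      position : Fin m → Fin m
      position e with e ≟ᶠ ε k
      ... | yes _ = Fin.zero
      ... | no _ = proj₁ (every-element-flips k e)

      position-flips : ∀ e → ε (k + toℕ (position e)) ≡ e
      position-flips e with e ≟ᶠ ε k
      ... | yes e≡εk = trans (cong ε (+-identityʳ k)) (sym e≡εk)
      ... | no _ = proj₂ (every-element-flips k e)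

      position-avoids-d : ∀ e → fromℕ< d<m ≢ position e
      position-avoids-d e d≡pos with e ≟ᶠ ε k
      ... | yes _ = <-irrefl (sym (trans (sym (toℕ-fromℕ< d<m)) (cong toℕ d≡pos))) 0<d
      ... | no e≢εk = e≢εk (trans (sym (proj₂ (every-element-flips k e)))
                         (trans (cong (λ r → ε (k + toℕ r)) (sym d≡pos))
                           (trans (cong (λ t → ε (k + t)) (toℕ-fromℕ< d<m)) εk+d≡εk)))

      punched : Fin m → Fin m₀
      punched e = punchOut (position-avoids-d e)

      punched-injective : ∀ {e e'} → punched e ≡ punched e' → e ≡ e'
      punched-injective {e} {e'} eq = trans (sym (position-flips e))
        (trans (cong (λ r → ε (k + toℕ r)) (punchOut-injective (position-avoids-d e) (position-avoids-d e') eq))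
               (position-flips e'))

  rises : ℕ → Bool
  rises j = isPos (U (suc j) (ε j))

  before-flip : ∀ j → U j (ε j) ≡ -‿ U (suc j) (ε j)
  before-flip j = trans (sym (-‿-involutive _)) (cong -‿_ (sym (ε-flips j)))

  rises-sign : ∀ {j} → rises j ≡ true → U j (ε j) ≡ neg × U (suc j) (ε j) ≡ pos
  rises-sign {j} up with U (suc j) (ε j) | before-flip j
  ... | pos | before = before , refl

  falls-sign : ∀ {j} → rises j ≡ false → U j (ε j) ≡ pos × U (suc j) (ε j) ≡ neg
  falls-sign {j} down with U (suc j) (ε j) | before-flip j | full (suc j) (ε j)
  ... | neg | before | _ = before , refl
  ... | zer | _ | nonzero = contradiction refl nonzero

  rises-antipodal : ∀ j → rises (j + m) ≡ not (rises j)
  rises-antipodal j = begin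
    isPos (U (suc j + m) (ε (j + m))) ≡⟨ cong (isPos ∘ U (suc j + m)) (ε-antipodal j) ⟩
    isPos (U (suc j + m) (ε j))       ≡⟨ cong isPos (antipodal (suc j) (ε j)) ⟩
    isPos (-‿ U (suc j) (ε j))        ≡⟨ isPos-opposite (full (suc j) (ε j)) ⟩
    not (rises j)                     ∎
    where open ≡-Reasoning

  rising-step : ∀ {j} → rises j ≡ true → U j ⊆⁺ U (suc j)
  rising-step {j} up f Ujf≡pos with f ≟ᶠ ε j
  ... | yes refl = proj₂ (rises-sign up)
  ... | no f≢εj = trans (others-kept j f≢εj) Ujf≡pos

  falling-step : ∀ {j} → rises j ≡ false → U (suc j) ⊆⁺ U j
  falling-step {j} down f U1+jf≡pos with f ≟ᶠ ε j
  ... | yes refl = contradiction (trans (sym U1+jf≡pos) (proj₂ (falls-sign down))) λ ()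
  ... | no f≢εj = trans (sym (others-kept j f≢εj)) U1+jf≡pos

  rising-run : ∀ x d → (∀ t → t < d → rises (x + t) ≡ true) → U x ⊆⁺ U (x + d)
  rising-run x zero _ f Uxf≡pos = trans (cong (λ i → U i f) (+-identityʳ x)) Uxf≡pos
  rising-run x (suc d) up f Uxf≡pos = subst (λ i → U i f ≡ pos) (sym (+-suc x d))
    (rising-step (up d ≤-refl) f (rising-run x d (λ t t<d → up t (m<n⇒m<1+n t<d)) f Uxf≡pos))

  falling-run : ∀ x d → (∀ t → t < d → rises (x + t) ≡ false) → U (x + d) ⊆⁺ U x
  falling-run x zero _ f Ux+0f≡pos = trans (sym (cong (λ i → U i f) (+-identityʳ x))) Ux+0f≡pos
  falling-run x (suc d) down f Ux+1+df≡pos = falling-run x d (λ t t<d → down t (m<n⇒m<1+n t<d)) f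
    (falling-step (down d ≤-refl) f (subst (λ i → U i f ≡ pos) (+-suc x d) Ux+1+df≡pos))

  Peak : ℕ → Set
  Peak j = rises j ≡ true × rises (suc j) ≡ false

  flipped-stays : ∀ k {t} → t < m → U (suc k + t) (ε k) ≡ U (suc k) (ε k)
  flipped-stays k {t} t<m = unflipped-constant (suc k) (ε k) t λ j j<t εk+1+j≡εk →
    flip-unique k (s≤s z≤n) (≤-<-trans j<t t<m) (trans (cong ε (+-suc k j)) εk+1+j≡εk)

  -- The element flipped out of the peak is negative at the next m vertices, and the element
  -- flipped into it, flipped back at step j + m, at the m vertices from suc j + m on.
  peak-isolated : ∀ {j} → Peak j → ∀ t → suc t < M → ¬ (U (suc j) ⊆⁺ U (suc j + suc t))
  peak-isolated {j} (up , down) t 1+t<M U⊆ with suc t ≤? m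
  ... | yes t<m = contradiction (begin
    pos                                ≡⟨ U⊆ (ε (suc j)) (proj₁ (falls-sign down)) ⟨
    U (suc j + suc t) (ε (suc j))      ≡⟨ cong (λ i → U i (ε (suc j))) (+-suc (suc j) t) ⟩
    U (suc (suc j) + t) (ε (suc j))    ≡⟨ flipped-stays (suc j) t<m ⟩
    U (suc (suc j)) (ε (suc j))        ≡⟨ proj₂ (falls-sign down) ⟩
    neg                                ∎) λ ()
    where open ≡-Reasoning
  ... | no 1+t≰m with m≤n⇒∃[o]m+o≡n (<⇒≤ (≰⇒> 1+t≰m))
  ...   | d , m+d≡1+t = contradiction (begin
    pos                                ≡⟨ U⊆ (ε j) (proj₂ (rises-sign up)) ⟨
    U (suc j + suc t) (ε j)            ≡⟨ cong₂ U (trans (cong (suc j +_) (sym m+d≡1+t)) (sym (+-assoc (suc j) m d))) refl ⟩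
    U (suc (j + m) + d) (ε j)          ≡⟨ cong (U (suc (j + m) + d)) (sym (ε-antipodal j)) ⟩
    U (suc (j + m) + d) (ε (j + m))    ≡⟨ flipped-stays (j + m) d<m ⟩
    U (suc (j + m)) (ε (j + m))        ≡⟨ proj₂ (falls-sign (trans (rises-antipodal j) (cong not up))) ⟩
    neg                                ∎) λ ()
    where
      open ≡-Reasoning
      d<m : d < m
      d<m = +-cancelˡ-< m d m (subst₂ _<_ (sym m+d≡1+t) (2*n≡n+n m) 1+t<M)

  U-reachable : ∀ a l → Σ ℕ λ d → d < M × U l ≈ U (a + d)
  U-reachable zero l = l % M , m%n<n l M , U-mod l
  U-reachable (suc a) l with U-reachable a l
  ... | suc d , 1+d<M , Ul≈ = d , <-trans (n<1+n d) 1+d<M , λ e → trans (Ul≈ e) (cong (λ i → U i e) (+-suc a d))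
  ... | zero , _ , Ul≈ = M ∸ 1 , ≤-refl , λ e → begin
    U l e                   ≡⟨ Ul≈ e ⟩
    U (a + 0) e             ≡⟨ cong (λ i → U i e) (+-identityʳ a) ⟩
    U a e                   ≡⟨ U-period a e ⟨
    U (a + M) e             ≡⟨ cong (λ i → U i e) (+-suc a (M ∸ 1)) ⟩
    U (suc a + (M ∸ 1)) e   ∎
    where open ≡-Reasoning

  IsMax : ℕ → Set
  IsMax k = ∀ l → U k ⊆⁺ U l → U l ⊆⁺ U k

  isMax-resp : ∀ {k k'} → U k ≈ U k' → IsMax k → IsMax k'
  isMax-resp {k} {k'} Uk≈Uk' max l Uk'⊆Ul f Ulf≡pos =
    trans (sym (Uk≈Uk' f)) (max l (λ f' p → Uk'⊆Ul f' (trans (sym (Uk≈Uk' f')) p)) f Ulf≡pos)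

  peak⇒isMax : ∀ {j} → Peak j → IsMax (suc j)
  peak⇒isMax {j} peak l U⊆Ul with U-reachable (suc j) l
  ... | zero , _ , Ul≈ = λ f Ulf≡pos → trans (cong (λ i → U i f) (sym (+-identityʳ (suc j)))) (trans (sym (Ul≈ f)) Ulf≡pos)
  ... | suc t , 1+t<M , Ul≈ = contradiction (λ f p → trans (sym (Ul≈ f)) (U⊆Ul f p)) (peak-isolated peak t 1+t<M)

  isMax⇒falls : ∀ {k} → IsMax k → rises k ≡ false
  isMax⇒falls {k} max with rises k in up
  ... | false = refl
  ... | true = contradiction (trans (sym (max (suc k) (rising-step up) (ε k) (proj₂ (rises-sign up))))
                                    (proj₁ (rises-sign up))) λ ()

  isMax⇒rises-into : ∀ {j} → IsMax (suc j) → rises j ≡ true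
  isMax⇒rises-into {j} max with rises j in up
  ... | true = refl
  ... | false = contradiction (trans (sym (max j (falling-step up) (ε j) (proj₁ (falls-sign up))))
                                     (proj₂ (falls-sign up))) λ ()

  antipode-covering : ∀ x y → U (x + m) ⊆⁺ U y → GAdj U x y
  antipode-covering x y U⊆ e with U x e in Uxe
  ... | pos = inj₁ refl
  ... | neg = inj₂ (U⊆ e (trans (antipodal x e) (cong -‿_ Uxe)))
  ... | zer = contradiction Uxe (full x e)

  GAdj-sym : ∀ {k l} → GAdj U k l → GAdj U l k
  GAdj-sym adj e = swap (adj e)

  GAdj-respʳ : ∀ {k l l'} → U l ≈ U l' → GAdj U k l → GAdj U k l'
  GAdj-respʳ Ul≈Ul' adj e = map₂ (trans (sym (Ul≈Ul' e))) (adj e)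

  U-full-turn : ∀ r → U (m + r + m) ≈ U r
  U-full-turn r e = trans (cong (λ i → U i e) index) (U-period r e)
    where
      index : m + r + m ≡ r + M
      index = trans (cong (_+ m) (+-comm m r)) (trans (+-assoc r m m) (cong (r +_) (sym (2*n≡n+n m))))

  -- Whether the step into vertex m + r rises; r is a turn when this changes from r to r + 1,
  -- i.e. when m + r is a peak or a valley.
  entering : ℕ → Bool
  entering r = rises (m₀ + r)

  open Changes entering
  open Enumeration changes

  entering-suc : ∀ r → entering (suc r) ≡ rises (m + r)
  entering-suc r = cong rises (+-suc m₀ r)

  entering-antipodal : ∀ r → entering (r + m) ≡ not (entering r)
  entering-antipodal r = trans (cong rises (sym (+-assoc m₀ r m))) (rises-antipodal (m₀ + r))

  changes-antipodal : ∀ r → changes (r + m) ≡ changes r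
  changes-antipodal r = begin
    entering (r + m) xor entering (suc r + m)    ≡⟨ cong₂ _xor_ (entering-antipodal r) (entering-antipodal (suc r)) ⟩
    not (entering r) xor not (entering (suc r))  ≡⟨ not-distribˡ-xor (entering r) _ ⟨
    not (entering r xor not (entering (suc r)))  ≡⟨ cong not (not-distribʳ-xor (entering r) _) ⟨
    not (not (changes r))                        ≡⟨ not-involutive _ ⟩
    changes r                                    ∎
    where open ≡-Reasoning

  turn-at : ∀ {r} → changes r ≡ true → entering r ≡ not (rises (m + r))
  turn-at {r} turn with entering r | rises (m + r) | trans (cong (entering r xor_) (sym (entering-suc r))) turn
  ... | true | false | _ = refl
  ... | false | true | _ = refl

  turn-from : ∀ {r} → entering r ≡ not (rises (m + r)) → changes r ≡ true
  turn-from {r} entering≡ with entering r | rises (m + r) | entering-suc r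
  ... | true | false | entering-1+r≡ = cong (true xor_) entering-1+r≡
  ... | false | true | entering-1+r≡ = cong (false xor_) entering-1+r≡

  -- For a turn r, whichever of the antipodal vertices r and m + r is a peak.
  vertex : ℕ → ℕ
  vertex r = if rises (m + r) then r else m + r

  vertex<M : ∀ {r} → r < m → vertex r < M
  vertex<M {r} r<m with rises (m + r)
  ... | true = <-≤-trans r<m (m≤m+n m (m + 0))
  ... | false = subst (m + r <_) (sym (2*n≡n+n m)) (+-monoʳ-< m r<m)

  vertex-injective : ∀ {r r'} → r < m → r' < m → vertex r ≡ vertex r' → r ≡ r'
  vertex-injective {r} {r'} r<m r'<m with rises (m + r) | rises (m + r')
  ... | true | true = λ r≡r' → r≡r'
  ... | true | false = λ r≡m+r' → contradiction (subst (_< m) r≡m+r' r<m) (≤⇒≯ (m≤m+n m r'))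
  ... | false | true = λ m+r≡r' → contradiction (subst (_< m) (sym m+r≡r') r'<m) (≤⇒≯ (m≤m+n m r))
  ... | false | false = +-cancelˡ-≡ m r r'

  vertex-antipodal : ∀ r → U (vertex (r + m)) ≈ U (vertex r)
  vertex-antipodal r with rises (m + r) | rises (m + (r + m))
                        | trans (cong rises (sym (+-assoc m r m))) (rises-antipodal (m + r))
  ... | true | false | _ = λ e → trans (cong (λ i → U i e) (sym (+-assoc m r m))) (U-full-turn r e)
  ... | false | true | _ = λ e → cong (λ i → U i e) (+-comm r m)

  turn⇒peak : ∀ {r} → changes r ≡ true → Σ ℕ λ j → Peak j × U (suc j) ≈ U (vertex r)
  turn⇒peak {r} turn with rises (m + r) in up
  ... | false = m₀ + r , (trans (turn-at turn) (cong not up) , up) , λ _ → refl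
  ... | true = m₀ + r + m ,
               (trans (rises-antipodal (m₀ + r)) (cong not (trans (turn-at turn) (cong not up))) ,
                trans (rises-antipodal (m + r)) (cong not up)) ,
               U-full-turn r

  isMax⇒turn : ∀ {k} → k < M → IsMax k → Σ ℕ λ r → r < m × changes r ≡ true × vertex r ≡ k
  isMax⇒turn {k} k<M max with k <? m
  ... | yes k<m = k , k<m , turn-from (trans entering-k (cong not (sym up))) , vertex-k
    where
      up : rises (m + k) ≡ true
      up = trans (cong rises (+-comm m k)) (trans (rises-antipodal k) (cong not (isMax⇒falls max)))
      entering-k : entering k ≡ false
      entering-k = trans (sym (not-involutive _)) (cong not (trans (sym (rises-antipodal (m₀ + k)))
                     (isMax⇒rises-into (isMax-resp (λ e → sym (U-full-turn k e)) max))))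
      vertex-k : vertex k ≡ k
      vertex-k rewrite up = refl
  ... | no k≮m with m≤n⇒∃[o]m+o≡n (≮⇒≥ k≮m)
  ...   | r , refl = r , r<m , turn-from (trans (isMax⇒rises-into max) (cong not (sym down))) , vertex-m+r
    where
      down = isMax⇒falls max
      r<m : r < m
      r<m = +-cancelˡ-< m r m (subst (m + r <_) (2*n≡n+n m) k<M)
      vertex-m+r : vertex r ≡ m + r
      vertex-m+r rewrite down = refl

  -- Between consecutive turns a < b the steps m + a, ..., m + b - 1 all rise or all fall.
  consecutive-turns-covering : ∀ {a b} → a < b → changes b ≡ true →
                               (∀ r → a < r → r < b → changes r ≡ false) → GAdj U (vertex a) (vertex b)
  consecutive-turns-covering {a} a<b turn no-turn with m≤n⇒∃[o]m+o≡n a<b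
  ... | t , refl = by-direction (rises (m + a)) refl
    where
      b = suc (a + t)

      entering-run : ∀ u → u ≤ t → entering (suc a + u) ≡ rises (m + a)
      entering-run u u≤t = trans (no-changes⇒constant (suc a) u λ u' u'<u →
          no-turn (suc a + u') (s≤s (m≤m+n a u')) (+-monoʳ-< (suc a) (<-≤-trans u'<u u≤t)))
        (entering-suc a)

      run : ∀ u → u < suc t → rises (m + a + u) ≡ rises (m + a)
      run u u<1+t = trans (cong rises (trans (cong suc (+-assoc m₀ a u)) (sym (+-suc m₀ (a + u)))))
                          (entering-run u (≤-pred u<1+t))

      turn-b : rises (m + b) ≡ not (rises (m + a))
      turn-b = trans (sym (not-involutive _)) (cong not (trans (sym (turn-at turn)) (entering-run t ≤-refl)))

      end : m + a + suc t ≡ m + b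
      end = trans (+-assoc m a (suc t)) (cong (m +_) (+-suc a t))

      by-direction : ∀ σ → rises (m + a) ≡ σ → GAdj U (vertex a) (vertex b)
      by-direction true up rewrite up | trans turn-b (cong not up) =
        antipode-covering a (m + b) λ f p →
          subst (λ i → U i f ≡ pos) end (rising-run (m + a) (suc t) (λ u u<1+t → trans (run u u<1+t) up) f
            (subst (λ i → U i f ≡ pos) (+-comm a m) p))
      by-direction false down rewrite down | trans turn-b (cong not down) =
        GAdj-sym (antipode-covering b (m + a) λ f p →
          falling-run (m + a) (suc t) (λ u u<1+t → trans (run u u<1+t) down) f
            (subst (λ i → U i f ≡ pos) (trans (+-comm b m) (sym end)) p))

  N : ℕ
  N = count m

  cycle : ℕ → ℕ
  cycle i = vertex (nth m i)

  -- The last turn below m and the first turn shifted by m are consecutive turns.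
  wrap-around-covering : ∀ {i} → N ≡ suc i → GAdj U (cycle i) (cycle 0)
  wrap-around-covering {i} N≡1+i = GAdj-respʳ (vertex-antipodal (nth m 0))
    (consecutive-turns-covering last<first+m (trans (changes-antipodal _) (nth-hit m 0<N)) no-turn)
    where
      i<N = subst (i <_) (sym N≡1+i) ≤-refl
      0<N = subst (0 <_) (sym N≡1+i) (s≤s z≤n)
      last<first+m : nth m i < nth m 0 + m
      last<first+m = <-≤-trans (nth-bound m i<N) (m≤n+m m (nth m 0))
      no-turn : ∀ r → nth m i < r → r < nth m 0 + m → changes r ≡ false
      no-turn r last<r r<first+m with r <? m
      ... | yes r<m = no-hit-after-last m N≡1+i last<r r<m
      ... | no r≮m with m≤n⇒∃[o]m+o≡n (≮⇒≥ r≮m)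
      ...   | r' , refl = trans (cong changes (+-comm m r')) (trans (changes-antipodal r')
                (no-hit-before-first m 0<N (+-cancelʳ-< m r' (nth m 0) (subst (_< nth m 0 + m) (+-comm m r') r<first+m))))

  N-odd : Σ ℕ λ j → N ≡ suc (2 * j)
  N-odd = odd⇒1+2* N (begin
    odd (count m)                         ≡⟨ count-changes-odd m ⟩
    entering 0 xor entering m             ≡⟨ cong (entering 0 xor_) (entering-antipodal 0) ⟩
    entering 0 xor not (entering 0)       ≡⟨ not-distribʳ-xor (entering 0) (entering 0) ⟨
    not (entering 0 xor entering 0)       ≡⟨ cong not (xor-same (entering 0)) ⟩
    true                                  ∎)
    where open ≡-Reasoning

  3≤N : (∀ k → ¬ (∀ e → U k e ≡ pos)) → 3 ≤ N
  3≤N no-positive with N-odd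
  ... | suc j , N≡ = subst (3 ≤_) (sym N≡) (s≤s (s≤s (≤-trans (s≤s z≤n) (m≤n+m _ j))))
  ... | zero , N≡1 = contradiction (λ e → [ id , id ]′ (wrap-around-covering N≡1 e)) (no-positive (cycle 0))

  inMaxPlus⇒isMax : ∀ {k} → InMaxPlus U k → IsMax k
  inMaxPlus⇒isMax (_ , max) l Uk⊆Ul f Ulf≡pos =
    max (l % M) (m%n<n l M) (λ e p → trans (sym (U-mod l e)) (Uk⊆Ul e p)) f (trans (sym (U-mod l f)) Ulf≡pos)

  maxPlus-oddCycle : (∀ k → ¬ (∀ e → U k e ≡ pos)) → MaxPlusIsOddCycle U
  maxPlus-oddCycle no-positive =
    N , cycle , N-odd , 3≤N no-positive , bounded , distinct , consecutive , closing , complete , maximal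
    where
      bounded : ∀ i → i < N → cycle i < M
      bounded i i<N = vertex<M (nth-bound m i<N)

      distinct : ∀ i i' → i < i' → i' < N → cycle i ≢ cycle i'
      distinct i i' i<i' i'<N cycle-i≡cycle-i' = <-irrefl (nth-injective m i<N i'<N
        (vertex-injective (nth-bound m i<N) (nth-bound m i'<N) cycle-i≡cycle-i')) i<i'
        where i<N = <-trans i<i' i'<N

      consecutive : ∀ i → suc i < N → GAdj U (cycle i) (cycle (suc i))
      consecutive i 1+i<N = consecutive-turns-covering (nth-increasing m 1+i<N) (nth-hit m 1+i<N)
                              λ r → no-hit-between-consecutive m 1+i<N

      closing : GAdj U (cycle (N ∸ 1)) (cycle 0)
      closing with N-odd
      ... | j , N≡ = subst (λ i → GAdj U (cycle i) (cycle 0)) (sym (cong (_∸ 1) N≡)) (wrap-around-covering N≡)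

      complete : ∀ k → InMaxPlus U k → Σ ℕ λ i → i < N × cycle i ≡ k
      complete k inMax with isMax⇒turn (proj₁ inMax) (inMaxPlus⇒isMax inMax)
      ... | r , r<m , turn , vertex-r≡k =
        count r , hit-count< turn r<m , trans (cong vertex (nth-count m r<m turn)) vertex-r≡k

      maximal : ∀ i → i < N → InMaxPlus U (cycle i)
      maximal i i<N with turn⇒peak (nth-hit m i<N)
      ... | j , peak , U≈ = bounded i i<N , λ l _ → isMax-resp U≈ (peak⇒isMax peak) l

module _ {m : ℕ} {T T' : ℕ → SignVec m} (T≈T' : ∀ k → k < 2 * m → T k ≈ T' k) where

  GAdj-cong : ∀ {k l} → k < 2 * m → l < 2 * m → GAdj T k l → GAdj T' k l
  GAdj-cong k<2m l<2m adj e = map (trans (sym (T≈T' _ k<2m e))) (trans (sym (T≈T' _ l<2m e))) (adj e)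

  InMaxPlus-cong : ∀ {k} → InMaxPlus T k → InMaxPlus T' k
  InMaxPlus-cong {k} (k<2m , max) = k<2m , λ l l<2m T'k⊆T'l f T'lf≡pos →
    trans (sym (T≈T' k k<2m f))
      (max l l<2m (λ e p → trans (T≈T' l l<2m e) (T'k⊆T'l e (trans (sym (T≈T' k k<2m e)) p))) f
           (trans (T≈T' l l<2m f) T'lf≡pos))

MaxPlusIsOddCycle-cong : ∀ {m} {T T' : ℕ → SignVec m} → (∀ k → k < 2 * m → T k ≈ T' k) →
                         MaxPlusIsOddCycle T → MaxPlusIsOddCycle T'
MaxPlusIsOddCycle-cong T≈T' (n , c , odd@(_ , refl) , 3≤n , bounded , distinct , consecutive , closing , complete , maximal) =
  n , c , odd , 3≤n , bounded , distinct ,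
  (λ i 1+i<n → GAdj-cong T≈T' (bounded i (<-trans (n<1+n i) 1+i<n)) (bounded (suc i) 1+i<n) (consecutive i 1+i<n)) ,
  GAdj-cong T≈T' (bounded (n ∸ 1) ≤-refl) (bounded 0 (s≤s z≤n)) closing ,
  (λ k → complete k ∘ InMaxPlus-cong (λ k k<2m e → sym (T≈T' k k<2m e))) ,
  (λ i i<n → InMaxPlus-cong T≈T' (maximal i i<n))

module PeriodicExtension (m₀ : ℕ) {L : SignVec (suc m₀) → Set} (om : IsOrientedMatroid L) (simple : Simple L)
                         (T : ℕ → SignVec (suc m₀)) (symmetric : SymmetricCycle L T) where

  m M : ℕ
  m = suc m₀
  M = 2 * m

  U : ℕ → SignVec m
  U k = T (k % M)

  U≈T : ∀ k → k < M → U k ≈ T k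
  U≈T k k<M e = cong (λ i → T i e) (m<n⇒m%n≡m k<M)

  adjacent : ∀ k → suc k < M → TopeAdj L (T k) (T (suc k))
  adjacent = proj₁ symmetric

  wrap : TopeAdj L (T (M ∸ 1)) (T 0)
  wrap = proj₁ (proj₂ symmetric)

  T-antipodal : ∀ k → k < m → T (k + m) ≈ negV (T k)
  T-antipodal = proj₂ (proj₂ (proj₂ symmetric))

  tope : ∀ k → k < M → IsTope L (T k)
  tope zero _ = proj₁ (proj₂ wrap)
  tope (suc k) 1+k<M = proj₁ (proj₂ (adjacent k 1+k<M))

  U-full : ∀ k e → U k e ≢ zer
  U-full k = tope-fullSupport om (proj₁ simple) (tope (k % M) (m%n<n k M))

  %-shift : ∀ a k → (a + k) % M ≡ (a + k % M) % M
  %-shift a k = begin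
    (a + k) % M               ≡⟨ %-distribˡ-+ a k M ⟩
    (a % M + k % M) % M       ≡⟨ cong (λ x → (a % M + x) % M) (m%n%n≡m%n k M) ⟨
    (a % M + k % M % M) % M   ≡⟨ %-distribˡ-+ a (k % M) M ⟨
    (a + k % M) % M           ∎
    where open ≡-Reasoning

  cycle-step : ∀ r → r < M → Σ (Fin m) (FlipAt (T r) (T (suc r % M)))
  cycle-step r r<M with suc r <? M
  ... | yes 1+r<M = subst (λ i → Σ (Fin m) (FlipAt (T r) (T i))) (sym (m<n⇒m%n≡m 1+r<M))
                      (adjacent-topes-flip om simple (adjacent r 1+r<M))
  ... | no 1+r≮M with ≤-antisym r<M (≮⇒≥ 1+r≮M)
  ...   | refl = subst (λ i → Σ (Fin m) (FlipAt (T (M ∸ 1)) (T i))) (sym (n%n≡0 M))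
                   (adjacent-topes-flip om simple wrap)

  U-step : ∀ k → Σ (Fin m) (FlipAt (U k) (U (suc k)))
  U-step k = subst (λ i → Σ (Fin m) (FlipAt (U k) (T i))) (sym (%-shift 1 k)) (cycle-step (k % M) (m%n<n k M))

  cycle-antipodal : ∀ r → r < M → T ((m + r) % M) ≈ negV (T r)
  cycle-antipodal r r<M with r <? m
  ... | yes r<m = λ e → trans (cong (λ i → T i e) (trans (m<n⇒m%n≡m m+r<M) (+-comm m r))) (T-antipodal r r<m e)
    where m+r<M = subst (m + r <_) (sym (2*n≡n+n m)) (+-monoʳ-< m r<m)
  ... | no r≮m with m≤n⇒∃[o]m+o≡n (≮⇒≥ r≮m)
  ...   | r' , refl = λ e → begin
    T ((m + (m + r')) % M) e   ≡⟨ cong (λ i → T i e) reduce ⟩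
    T r' e                     ≡⟨ -‿-involutive (T r' e) ⟨
    -‿ (-‿ T r' e)            ≡⟨ cong -‿_ (sym (trans (cong (λ i → T i e) (+-comm m r')) (T-antipodal r' r'<m e))) ⟩
    -‿ T (m + r') e            ∎
    where
      open ≡-Reasoning
      r'<m : r' < m
      r'<m = +-cancelˡ-< m r' m (subst (m + r' <_) (2*n≡n+n m) r<M)
      reduce : (m + (m + r')) % M ≡ r'
      reduce = begin
        (m + (m + r')) % M    ≡⟨ cong (_% M) (sym (+-assoc m m r')) ⟩
        (m + m + r') % M      ≡⟨ cong (λ n → (n + r') % M) (2*n≡n+n m) ⟨
        (M + r') % M          ≡⟨ cong (_% M) (+-comm M r') ⟩
        (r' + M) % M          ≡⟨ [m+n]%n≡m%n r' M ⟩
        r' % M                ≡⟨ m<n⇒m%n≡m (<-≤-trans r'<m (m≤m+n m (m + 0))) ⟩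
        r'                    ∎

  U-antipodal : ∀ k → U (k + m) ≈ negV (U k)
  U-antipodal k e = trans (cong (λ i → T i e) (trans (cong (_% M) (+-comm k m)) (%-shift m k)))
                          (cycle-antipodal (k % M) (m%n<n k M) e)

mainTheorem5 : (m : ℕ) (L : SignVec m → Set) → IsOrientedMatroid L → RankAtLeast2 L → Simple L →
    (T : ℕ → SignVec m) → SymmetricCycle L T →
    (∀ k → k < 2 * m → ¬ (T k ≈ posV)) →
    MaxPlusIsOddCycle T
mainTheorem5 zero L om (_ , _ , _ , _ , (_ , 0≉X) , _) simple T symmetric not-positive = contradiction (λ ()) 0≉X
mainTheorem5 (suc m₀) L om _ simple T symmetric not-positive =
  MaxPlusIsOddCycle-cong U≈T (maxPlus-oddCycle no-positive)
  where
    open PeriodicExtension m₀ om simple T symmetric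
    open FlipSequence m₀ U U-full U-step U-antipodal using (maxPlus-oddCycle)
    no-positive : ∀ k → ¬ (∀ e → U k e ≡ pos)
    no-positive k = not-positive (k % M) (m%n<n k M)
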